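{- Let $f(t)$ be a delta series with complex coefficients and let $\bar f(t)$ be its compositional inverse. For every integer $n \ge 0$, \[ B_{n,\bar{f}(t)}=\sum_{j=0}^{n}\binom{n+1}{j+1}\binom{n+j}{j}^{ -1}(-1)^{j}\big(\bar{f}^{\prime}(0)\big)^{ -1-j}S_{2}(n+j,j; f(t)). \]
   Context: All series are formal power series in $t$ over $\mathbb{C}$. A delta series is a formal power series $f(t)$ with $f(0)=0$, $f'(0)\neq0$; its compositional inverse $\bar f(t)$ is again a delta series, so $\bar f'(0)\ne0$. The Bernoulli numbers associated with $\bar f$ are defined by $\frac{t}{e^{\bar f(t)}-1}=\sum_{n\ge0}B_{n,\bar f(t)}\frac{t^n}{n!}$. The Stirling numbers of the second kind associated with $f$ are defined by $\frac{1}{k!}\big(e^{\bar f(t)}-1\big)^k=\sum_{n\ge k}S_2(n,k;f(t))\frac{t^n}{n!}$ for $k\ge0$. -}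

module Defs where

open import Level using (_⊔_)
open import Data.Nat as ℕ using (ℕ; zero; suc; _∸_)
open import Data.Nat using (_!)
open import Data.Nat.Combinatorics using (_C_)
open import Data.Product using (_×_)
open import Relation.Nullary using (¬_)
open import Algebra.Bundles using (CommutativeRing)

-- A field of characteristic zero (the standard library has no Field bundle):
-- a commutative commRing with a (total) operation _⁻¹ that is a multiplicative
-- inverse on every nonzero element, and in which n·1 ≉ 0 for all n ≥ 1
-- (this also gives 1 ≉ 0).  ℂ is the instance intended by the paper.
-- n · 1 in a commutative commRing
fromℕ : ∀ {c ℓ} (R : CommutativeRing c ℓ) → ℕ → CommutativeRing.Carrier R
fromℕ R zero    = CommutativeRing.0# R
fromℕ R (suc n) = CommutativeRing._+_ R (CommutativeRing.1# R) (fromℕ R n)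

record CharZeroField c ℓ : Set (Level.suc (c ⊔ ℓ)) where
  field
    commRing : CommutativeRing c ℓ
  open CommutativeRing commRing public hiding (ring)
  field
    _⁻¹      : Carrier → Carrier
    inverseʳ : ∀ x → ¬ (x ≈ 0#) → (x * (x ⁻¹)) ≈ 1#
    charZero : ∀ n → ¬ (fromℕ commRing (suc n) ≈ 0#)

module Series {c ℓ} (F : CharZeroField c ℓ) where
  open CharZeroField F

  fromℕᶠ : ℕ → Carrier
  fromℕᶠ = fromℕ commRing

  _^ᶠ_ : Carrier → ℕ → Carrier
  x ^ᶠ zero  = 1#
  x ^ᶠ suc k = x * (x ^ᶠ k)

  sumTo : ℕ → (ℕ → Carrier) → Carrier
  sumTo zero    g = g 0
  sumTo (suc n) g = sumTo n g + g (suc n)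

  PowerSeries : Set c
  PowerSeries = ℕ → Carrier

  _≈ₛ_ : PowerSeries → PowerSeries → Set ℓ
  a ≈ₛ b = ∀ n → a n ≈ b n

  oneₛ : PowerSeries
  oneₛ zero    = 1#
  oneₛ (suc _) = 0#

  tₛ : PowerSeries
  tₛ 1 = 1#
  tₛ _ = 0#

  _*ₛ_ : PowerSeries → PowerSeries → PowerSeries
  (a *ₛ b) n = sumTo n (λ i → a i * b (n ∸ i))

  _^ₛ_ : PowerSeries → ℕ → PowerSeries
  a ^ₛ zero  = oneₛ
  a ^ₛ suc k = a *ₛ (a ^ₛ k)

  -- composition g(h(t)), meaningful when h(0) = 0
  _∘ₛ_ : PowerSeries → PowerSeries → PowerSeries
  (g ∘ₛ h) n = sumTo n (λ k → g k * (h ^ₛ k) n)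

  -- delta series: f(0) = 0, f'(0) ≠ 0  (f'(0) is the coefficient of t)
  IsDelta : PowerSeries → Set ℓ
  IsDelta f = (f 0 ≈ 0#) × ¬ (f 1 ≈ 0#)

  IsCompInverse : PowerSeries → PowerSeries → Set ℓ
  IsCompInverse f fbar = ((f ∘ₛ fbar) ≈ₛ tₛ) × ((fbar ∘ₛ f) ≈ₛ tₛ)

  -- e^{h(t)} - 1 = Σ_{k≥1} h(t)^k / k!, for h with h(0) = 0
  -- (the k-th term only contributes to coefficients of degree ≥ k)
  expm1 : PowerSeries → PowerSeries
  expm1 h n = sumTo n term
    where
      term : ℕ → Carrier
      term zero    = 0#
      term (suc k) = (fromℕᶠ (suc k !) ⁻¹) * (h ^ₛ suc k) n

  -- Stirling numbers of the second kind associated with f, given its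
  -- compositional inverse fbar:
  --   (1/k!) (e^{fbar(t)} - 1)^k = Σ_n S₂(n,k;f) t^n / n!
  S₂ : PowerSeries → ℕ → ℕ → Carrier
  S₂ fbar n k = fromℕᶠ (n !) * ((fromℕᶠ (k !) ⁻¹) * (expm1 fbar ^ₛ k) n)

  -- G is the series t / (e^{fbar(t)} - 1), characterised as the series with
  -- G(t) · (e^{fbar(t)} - 1) = t; then B_{n,fbar} = n! · [t^n] G.
  IsBernoulliGF : PowerSeries → PowerSeries → Set ℓ
  IsBernoulliGF fbar G = (G *ₛ expm1 fbar) ≈ₛ tₛ

  Bernoulli : PowerSeries → ℕ → Carrier
  Bernoulli G n = fromℕᶠ (n !) * G n

  rhs : PowerSeries → ℕ → Carrier
  rhs fbar n = sumTo n λ j →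
    fromℕᶠ (suc n C suc j) * ((fromℕᶠ ((n ℕ.+ j) C j) ⁻¹) *
      (((- 1#) ^ᶠ j) * (((fbar 1 ⁻¹) ^ᶠ suc j) * S₂ fbar (n ℕ.+ j) j)))

-- Write e^{fbar(t)} - 1 = t D(t); then D(0) = fbar'(0) =: a and t / (e^{fbar(t)} - 1) = 1 / D.
-- Since u = 1 - a⁻¹ D has no constant term, [t^n] (1 / D) = a⁻¹ [t^n] Σ_{k ≤ n} u^k, and
-- Σ_{k ≤ n} (1 + x)^k = Σ_j C(n+1, j+1) x^j with x = -a⁻¹ D.  Finally [t^n] D^j = [t^{n+j}] (e^{fbar} - 1)^j
-- = j! S₂(n+j, j; f) / (n+j)!, and (n+j)! = C(n+j, j) j! n! turns n! [t^n] (1 / D) into the stated sum.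

module Submission where

open import Defs
open import Data.Nat using (ℕ)

open import Data.Nat as Nat using (zero; suc; _∸_; _≤_; _<_; z≤n; s≤s; _!)
import Data.Nat.Properties as ℕₚ
open import Data.Nat.Combinatorics using (_C_; nCk≡n!/k![n-k]!; k![n∸k]!∣n!)
open import Data.Nat.DivMod using (_/_; m/n*n≡m)
open import Data.Fin as Fin using (toℕ)
open import Data.Product using (_,_)
open import Relation.Binary.PropositionalEquality as ≡ using (_≡_; _≢_)
open import Relation.Nullary using (¬_; contradiction)
open import Algebra.Bundles using (CommutativeRing)
import Algebra.Properties.Ring
import Algebra.Properties.CommutativeSemigroup

[m+n]!≡[m+n]Cn*n!*m! : ∀ m n → (m Nat.+ n) ! ≡ ((m Nat.+ n) C n) Nat.* (n ! Nat.* m !)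
[m+n]!≡[m+n]Cn*n!*m! m n = begin
  (m + n) !                                                  ≡⟨ m/n*n≡m (k![n∸k]!∣n! n≤m+n) ⟨
  ((m + n) ! / (n ! * (m + n ∸ n) !)) * (n ! * (m + n ∸ n) !) ≡⟨ cong (_* (n ! * (m + n ∸ n) !)) (nCk≡n!/k![n-k]! n≤m+n) ⟨
  ((m + n) C n) * (n ! * (m + n ∸ n) !)                      ≡⟨ cong (λ k → ((m + n) C n) * (n ! * k !)) (m+n∸n≡m m n) ⟩
  ((m + n) C n) * (n ! * m !)                                ∎
  where
  open Nat using (_+_; _*_)
  open ℕₚ using (m+n∸n≡m; _!*_!≢0)
  open ≡ using (cong)
  open ≡.≡-Reasoning
  n≤m+n : n ≤ m + n
  n≤m+n = ℕₚ.m≤n+m n m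
  instance
    n!*m!≢0 : Nat.NonZero (n ! * (m + n ∸ n) !)
    n!*m!≢0 = n !* (m + n ∸ n) !≢0

module _ {c ℓ} (R : CommutativeRing c ℓ) where
  open CommutativeRing R
  open import Algebra.Properties.Semiring.Mult semiring using (_×_; ×-congʳ; ×-comm-*; ×1-homo-*)
  open import Algebra.Properties.Semiring.Exp semiring using (_^_)
  open import Algebra.Properties.Semiring.Sum semiring using (sum⁺-syntax; sum-cong-≋; *-distribˡ-sum)
  open import Algebra.Properties.Ring ring using (-‿distribˡ-*)
  import Algebra.Properties.CommutativeSemiring.Binomial commutativeSemiring as Binomial
  open import Relation.Binary.Reasoning.Setoid setoid

  fromℕ≡×1# : ∀ m → fromℕ R m ≡ m × 1#
  fromℕ≡×1# zero    = ≡.refl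
  fromℕ≡×1# (suc m) = ≡.cong (1# +_) (fromℕ≡×1# m)

  fromℕ-homo-* : ∀ m n → fromℕ R (m Nat.* n) ≈ fromℕ R m * fromℕ R n
  fromℕ-homo-* m n rewrite fromℕ≡×1# (m Nat.* n) | fromℕ≡×1# m | fromℕ≡×1# n = ×1-homo-* m n

  1#^n≈1# : ∀ n → 1# ^ n ≈ 1#
  1#^n≈1# zero    = refl
  1#^n≈1# (suc n) = trans (*-identityˡ _) (1#^n≈1# n)

  -- ((x + 1)^(n+1) - 1) / x, i.e. Σ_{k ≤ n} (x + 1)^k
  binomialQuotient : Carrier → ℕ → Carrier
  binomialQuotient x n = ∑[ j ≤ n ] ((suc n C suc (toℕ j)) × x ^ toℕ j)

  [x+1]^[n+1]≈x*binomialQuotient+1 : ∀ x n → (x + 1#) ^ suc n ≈ x * binomialQuotient x n + 1#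
  [x+1]^[n+1]≈x*binomialQuotient+1 x n = begin
    (x + 1#) ^ suc n                                           ≈⟨ Binomial.theorem (suc n) x 1# ⟩
    Binomial.binomialTerm x 1# (suc n) Fin.zero
      + ∑[ j ≤ n ] Binomial.binomialTerm x 1# (suc n) (Fin.suc j) ≈⟨ +-cong constant (sum-cong-≋ term) ⟩
    1# + ∑[ j ≤ n ] (x * a j)                                  ≈⟨ +-congˡ (*-distribˡ-sum x a) ⟨
    1# + x * binomialQuotient x n                              ≈⟨ +-comm _ _ ⟩
    x * binomialQuotient x n + 1#                              ∎
    where
    a : Fin.Fin (suc n) → Carrier
    a j = (suc n C suc (toℕ j)) × x ^ toℕ j
    constant : Binomial.binomialTerm x 1# (suc n) Fin.zero ≈ 1#
    constant = trans (+-identityʳ _) (trans (*-identityˡ _) (1#^n≈1# (suc n)))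
    term : ∀ j → Binomial.binomialTerm x 1# (suc n) (Fin.suc j) ≈ x * a j
    term j = trans (×-congʳ (suc n C suc (toℕ j)) (trans (*-congˡ (1#^n≈1# (n ∸ toℕ j))) (*-identityʳ _)))
                   (sym (×-comm-* (suc n C suc (toℕ j)) x (x ^ toℕ j)))

  *[x+1]^[n+1]≈-*binomialQuotient : ∀ {g x k} → g * x ≈ - k → ∀ n →
    g * (x + 1#) ^ suc n ≈ g - k * binomialQuotient x n
  *[x+1]^[n+1]≈-*binomialQuotient {g} {x} {k} g*x≈-k n = begin
    g * (x + 1#) ^ suc n       ≈⟨ *-congˡ ([x+1]^[n+1]≈x*binomialQuotient+1 x n) ⟩
    g * (x * r + 1#)           ≈⟨ distribˡ g (x * r) 1# ⟩
    g * (x * r) + g * 1#       ≈⟨ +-cong (sym (*-assoc g x r)) (*-identityʳ g) ⟩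
    (g * x) * r + g            ≈⟨ +-congʳ (*-congʳ g*x≈-k) ⟩
    - k * r + g                ≈⟨ +-congʳ (-‿distribˡ-* k r) ⟨
    - (k * r) + g              ≈⟨ +-comm _ g ⟩
    g - k * r                  ∎
    where
    r : Carrier
    r = binomialQuotient x n

module PowerSeriesRing {c ℓ} (F : CharZeroField c ℓ) where
  open CharZeroField F hiding (zero)
  open Series F
  open import Algebra.Properties.CommutativeSemigroup +-commutativeSemigroup using (interchange)
  open import Relation.Binary.Reasoning.Setoid setoid

  sumTo-cong≤ : ∀ n {g h : ℕ → Carrier} → (∀ i → i ≤ n → g i ≈ h i) → sumTo n g ≈ sumTo n h
  sumTo-cong≤ zero    g≈h = g≈h 0 z≤n
  sumTo-cong≤ (suc n) g≈h =
    +-cong (sumTo-cong≤ n (λ i i≤n → g≈h i (ℕₚ.m≤n⇒m≤1+n i≤n))) (g≈h (suc n) ℕₚ.≤-refl)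

  sumTo-cong : ∀ n {g h : ℕ → Carrier} → (∀ i → g i ≈ h i) → sumTo n g ≈ sumTo n h
  sumTo-cong n g≈h = sumTo-cong≤ n (λ i _ → g≈h i)

  sumTo-zero : ∀ n {g : ℕ → Carrier} → (∀ i → i ≤ n → g i ≈ 0#) → sumTo n g ≈ 0#
  sumTo-zero zero    g≈0 = g≈0 0 z≤n
  sumTo-zero (suc n) g≈0 = trans
    (+-cong (sumTo-zero n (λ i i≤n → g≈0 i (ℕₚ.m≤n⇒m≤1+n i≤n))) (g≈0 (suc n) ℕₚ.≤-refl))
    (+-identityˡ 0#)

  sumTo-distrib-+ : ∀ n (g h : ℕ → Carrier) → sumTo n (λ i → g i + h i) ≈ sumTo n g + sumTo n h
  sumTo-distrib-+ zero    g h = refl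
  sumTo-distrib-+ (suc n) g h =
    trans (+-congʳ (sumTo-distrib-+ n g h)) (interchange _ _ _ _)

  *-distribˡ-sumTo : ∀ n k (g : ℕ → Carrier) → k * sumTo n g ≈ sumTo n (λ i → k * g i)
  *-distribˡ-sumTo zero    k g = refl
  *-distribˡ-sumTo (suc n) k g = trans (distribˡ _ _ _) (+-congʳ (*-distribˡ-sumTo n k g))

  sumTo-unfoldˡ : ∀ n (g : ℕ → Carrier) → sumTo (suc n) g ≈ g 0 + sumTo n (λ i → g (suc i))
  sumTo-unfoldˡ zero    g = refl
  sumTo-unfoldˡ (suc n) g = trans (+-congʳ (sumTo-unfoldˡ n g)) (+-assoc _ _ _)

  sumTo-reverse : ∀ n (g : ℕ → Carrier) → sumTo n g ≈ sumTo n (λ i → g (n ∸ i))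
  sumTo-reverse zero    g = refl
  sumTo-reverse (suc n) g = begin
    sumTo n g + g (suc n)                     ≈⟨ +-congʳ (sumTo-reverse n g) ⟩
    sumTo n (λ i → g (n ∸ i)) + g (suc n)     ≈⟨ +-comm _ _ ⟩
    g (suc n) + sumTo n (λ i → g (n ∸ i))     ≈⟨ sumTo-unfoldˡ n (λ i → g (suc n ∸ i)) ⟨
    sumTo (suc n) (λ i → g (suc n ∸ i))       ∎

  infixl 6 _+ₛ_

  _+ₛ_ : PowerSeries → PowerSeries → PowerSeries
  (a +ₛ b) n = a n + b n

  -ₛ_ : PowerSeries → PowerSeries
  (-ₛ a) n = - a n

  0ₛ : PowerSeries
  0ₛ _ = 0#

  constₛ : Carrier → PowerSeries
  constₛ k zero    = k
  constₛ k (suc _) = 0#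

  shiftₛ : PowerSeries → PowerSeries
  shiftₛ a n = a (suc n)

  ≈ₛ-refl : ∀ {a} → a ≈ₛ a
  ≈ₛ-refl n = refl

  ≈ₛ-sym : ∀ {a b} → a ≈ₛ b → b ≈ₛ a
  ≈ₛ-sym a≈b n = sym (a≈b n)

  ≈ₛ-trans : ∀ {a b d} → a ≈ₛ b → b ≈ₛ d → a ≈ₛ d
  ≈ₛ-trans a≈b b≈d n = trans (a≈b n) (b≈d n)

  *ₛ-cong : ∀ {a a′ b b′} → a ≈ₛ a′ → b ≈ₛ b′ → (a *ₛ b) ≈ₛ (a′ *ₛ b′)
  *ₛ-cong a≈a′ b≈b′ n = sumTo-cong n (λ i → *-cong (a≈a′ i) (b≈b′ (n ∸ i)))

  *ₛ-unfold : ∀ a b n → (a *ₛ b) (suc n) ≈ a 0 * b (suc n) + (shiftₛ a *ₛ b) n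
  *ₛ-unfold a b n = sumTo-unfoldˡ n _

  *ₛ-comm : ∀ a b → (a *ₛ b) ≈ₛ (b *ₛ a)
  *ₛ-comm a b n = trans (sumTo-reverse n _) (sumTo-cong≤ n (λ i i≤n →
    trans (*-comm _ _) (*-congʳ (reflexive (≡.cong b (ℕₚ.m∸[m∸n]≡n i≤n))))))

  *ₛ-distribˡ : ∀ d a b → (d *ₛ (a +ₛ b)) ≈ₛ ((d *ₛ a) +ₛ (d *ₛ b))
  *ₛ-distribˡ d a b n = trans (sumTo-cong n (λ i → distribˡ _ _ _)) (sumTo-distrib-+ n _ _)

  *ₛ-distribʳ : ∀ d a b → ((a +ₛ b) *ₛ d) ≈ₛ ((a *ₛ d) +ₛ (b *ₛ d))
  *ₛ-distribʳ d a b n = trans (sumTo-cong n (λ i → distribʳ _ _ _)) (sumTo-distrib-+ n _ _)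

  *ₛ-identityˡ : ∀ b → (oneₛ *ₛ b) ≈ₛ b
  *ₛ-identityˡ b zero    = *-identityˡ _
  *ₛ-identityˡ b (suc n) = begin
    (oneₛ *ₛ b) (suc n)               ≈⟨ *ₛ-unfold oneₛ b n ⟩
    1# * b (suc n) + (0ₛ *ₛ b) n       ≈⟨ +-cong (*-identityˡ _) (sumTo-zero n (λ i _ → zeroˡ _)) ⟩
    b (suc n) + 0#                    ≈⟨ +-identityʳ _ ⟩
    b (suc n)                         ∎

  *ₛ-scaleˡ : ∀ k a b n → ((λ i → k * a i) *ₛ b) n ≈ k * (a *ₛ b) n
  *ₛ-scaleˡ k a b n = trans (sumTo-cong n (λ i → *-assoc _ _ _)) (sym (*-distribˡ-sumTo n k _))

  *ₛ-assoc : ∀ a b d → ((a *ₛ b) *ₛ d) ≈ₛ (a *ₛ (b *ₛ d))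
  *ₛ-assoc a b d zero    = *-assoc _ _ _
  *ₛ-assoc a b d (suc n) = begin
    ((a *ₛ b) *ₛ d) (suc n)
      ≈⟨ *ₛ-unfold (a *ₛ b) d n ⟩
    (a 0 * b 0) * d (suc n) + (shiftₛ (a *ₛ b) *ₛ d) n
      ≈⟨ +-congˡ (*ₛ-cong (*ₛ-unfold a b) (≈ₛ-refl {d}) n) ⟩
    (a 0 * b 0) * d (suc n) + (((λ i → a 0 * shiftₛ b i) +ₛ (shiftₛ a *ₛ b)) *ₛ d) n
      ≈⟨ +-congˡ (trans (*ₛ-distribʳ d _ _ n) (+-cong (*ₛ-scaleˡ (a 0) (shiftₛ b) d n) (*ₛ-assoc (shiftₛ a) b d n))) ⟩
    (a 0 * b 0) * d (suc n) + (a 0 * (shiftₛ b *ₛ d) n + (shiftₛ a *ₛ (b *ₛ d)) n)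
      ≈⟨ +-assoc _ _ _ ⟨
    ((a 0 * b 0) * d (suc n) + a 0 * (shiftₛ b *ₛ d) n) + (shiftₛ a *ₛ (b *ₛ d)) n
      ≈⟨ +-congʳ (trans (+-congʳ (*-assoc _ _ _)) (sym (distribˡ _ _ _))) ⟩
    a 0 * (b 0 * d (suc n) + (shiftₛ b *ₛ d) n) + (shiftₛ a *ₛ (b *ₛ d)) n
      ≈⟨ +-congʳ (*-congˡ (*ₛ-unfold b d n)) ⟨
    a 0 * (b *ₛ d) (suc n) + (shiftₛ a *ₛ (b *ₛ d)) n
      ≈⟨ *ₛ-unfold a (b *ₛ d) n ⟨
    (a *ₛ (b *ₛ d)) (suc n)
      ∎

  powerSeriesRing : CommutativeRing c ℓ
  powerSeriesRing = record
    { Carrier = PowerSeries ; _≈_ = _≈ₛ_ ; _+_ = _+ₛ_ ; _*_ = _*ₛ_ ; -_ = -ₛ_ ; 0# = 0ₛ ; 1# = oneₛ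
    ; isCommutativeRing = record
      { isRing = record
        { +-isAbelianGroup = record
          { isGroup = record
            { isMonoid = record
              { isSemigroup = record
                { isMagma = record
                  { isEquivalence = record { refl = λ {a} → ≈ₛ-refl {a} ; sym = ≈ₛ-sym ; trans = ≈ₛ-trans }
                  ; ∙-cong = λ a≈a′ b≈b′ n → +-cong (a≈a′ n) (b≈b′ n) }
                ; assoc = λ a b d n → +-assoc (a n) (b n) (d n) }
              ; identity = (λ a n → +-identityˡ (a n)) , (λ a n → +-identityʳ (a n)) }
            ; inverse = (λ a n → -‿inverseˡ (a n)) , (λ a n → -‿inverseʳ (a n))
            ; ⁻¹-cong = λ a≈b n → -‿cong (a≈b n) }
          ; comm = λ a b n → +-comm (a n) (b n) }
        ; *-cong = *ₛ-cong
        ; *-assoc = *ₛ-assoc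
        ; *-identity = *ₛ-identityˡ , (λ b → ≈ₛ-trans (*ₛ-comm b oneₛ) (*ₛ-identityˡ b))
        ; distrib = *ₛ-distribˡ , *ₛ-distribʳ }
      ; *-comm = *ₛ-comm } }

  module 𝕊 = CommutativeRing powerSeriesRing
  open import Algebra.Properties.Semiring.Mult 𝕊.semiring public using (_×_)
  open import Algebra.Properties.CommutativeSemiring.Exp 𝕊.commutativeSemiring public using (_^_; ^-distrib-*; ^-congˡ)
  open import Algebra.Properties.Semiring.Sum 𝕊.semiring public using (sum⁺-syntax)
  module 𝕊ᵖ = Algebra.Properties.Ring 𝕊.ring
  module 𝕊ᶜ = Algebra.Properties.CommutativeSemigroup 𝕊.*-commutativeSemigroup

  ^ₛ≡^ : ∀ a k → a ^ₛ k ≡ a ^ k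
  ^ₛ≡^ a zero    = ≡.refl
  ^ₛ≡^ a (suc k) = ≡.cong (a *ₛ_) (^ₛ≡^ a k)

  coeff-∑ : ∀ n (S : ℕ → PowerSeries) m → (∑[ j ≤ n ] S (toℕ j)) m ≈ sumTo n (λ j → S j m)
  coeff-∑ zero    S m = +-identityʳ _
  coeff-∑ (suc n) S m =
    trans (+-congˡ (coeff-∑ n (λ j → S (suc j)) m)) (sym (sumTo-unfoldˡ n (λ j → S j m)))

  coeff-× : ∀ k X m → (k × X) m ≈ fromℕᶠ k * X m
  coeff-× zero    X m = sym (zeroˡ _)
  coeff-× (suc k) X m =
    trans (+-cong (sym (*-identityˡ _)) (coeff-× k X m)) (sym (distribʳ _ _ _))

  coeff-constₛ-*ₛ : ∀ k X n → (constₛ k *ₛ X) n ≈ k * X n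
  coeff-constₛ-*ₛ k X zero    = refl
  coeff-constₛ-*ₛ k X (suc n) = begin
    (constₛ k *ₛ X) (suc n)             ≈⟨ *ₛ-unfold (constₛ k) X n ⟩
    k * X (suc n) + (0ₛ *ₛ X) n          ≈⟨ +-congˡ (sumTo-zero n (λ i _ → zeroˡ _)) ⟩
    k * X (suc n) + 0#                  ≈⟨ +-identityʳ _ ⟩
    k * X (suc n)                       ∎

  constₛ-^ : ∀ k j → (constₛ k ^ j) ≈ₛ constₛ (k ^ᶠ j)
  constₛ-^ k zero    zero    = refl
  constₛ-^ k zero    (suc n) = refl
  constₛ-^ k (suc j) n       =
    trans (coeff-constₛ-*ₛ k (constₛ k ^ j) n) (trans (*-congˡ (constₛ-^ k j n)) (*-constₛ n))
    where
    *-constₛ : ∀ n → k * constₛ (k ^ᶠ j) n ≈ constₛ (k ^ᶠ suc j) n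
    *-constₛ zero    = refl
    *-constₛ (suc n) = zeroʳ k

  shiftₛ-tₛ : shiftₛ tₛ ≈ₛ oneₛ
  shiftₛ-tₛ zero    = refl
  shiftₛ-tₛ (suc n) = refl

  coeff-tₛ-*ₛ : ∀ X n → (tₛ *ₛ X) (suc n) ≈ X n
  coeff-tₛ-*ₛ X n = begin
    (tₛ *ₛ X) (suc n)                   ≈⟨ *ₛ-unfold tₛ X n ⟩
    0# * X (suc n) + (shiftₛ tₛ *ₛ X) n  ≈⟨ +-cong (zeroˡ _) (*ₛ-cong shiftₛ-tₛ (≈ₛ-refl {X}) n) ⟩
    0# + (oneₛ *ₛ X) n                  ≈⟨ +-identityˡ _ ⟩
    (oneₛ *ₛ X) n                       ≈⟨ *ₛ-identityˡ X n ⟩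
    X n                                 ∎

  coeff-tₛ^-*ₛ : ∀ j X n → ((tₛ ^ j) *ₛ X) (n Nat.+ j) ≈ X n
  coeff-tₛ^-*ₛ zero    X n = trans (reflexive (≡.cong (oneₛ *ₛ X) (ℕₚ.+-identityʳ n))) (*ₛ-identityˡ X n)
  coeff-tₛ^-*ₛ (suc j) X n = begin
    ((tₛ *ₛ (tₛ ^ j)) *ₛ X) (n Nat.+ suc j)    ≡⟨ ≡.cong ((tₛ *ₛ (tₛ ^ j)) *ₛ X) (ℕₚ.+-suc n j) ⟩
    ((tₛ *ₛ (tₛ ^ j)) *ₛ X) (suc (n Nat.+ j))  ≈⟨ *ₛ-assoc tₛ (tₛ ^ j) X (suc (n Nat.+ j)) ⟩
    (tₛ *ₛ ((tₛ ^ j) *ₛ X)) (suc (n Nat.+ j))  ≈⟨ coeff-tₛ-*ₛ ((tₛ ^ j) *ₛ X) (n Nat.+ j) ⟩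
    ((tₛ ^ j) *ₛ X) (n Nat.+ j)                ≈⟨ coeff-tₛ^-*ₛ j X n ⟩
    X n                                        ∎

  ≈tₛ*ₛshiftₛ : ∀ {a} → a 0 ≈ 0# → a ≈ₛ (tₛ *ₛ shiftₛ a)
  ≈tₛ*ₛshiftₛ a₀≈0 zero    = trans a₀≈0 (sym (zeroˡ _))
  ≈tₛ*ₛshiftₛ {a} a₀≈0 (suc n) = sym (coeff-tₛ-*ₛ (shiftₛ a) n)

  coeff-shiftₛ^ : ∀ {a} → a 0 ≈ 0# → ∀ j n → (shiftₛ a ^ j) n ≈ (a ^ j) (n Nat.+ j)
  coeff-shiftₛ^ {a} a₀≈0 j n = begin
    (shiftₛ a ^ j) n                          ≈⟨ coeff-tₛ^-*ₛ j (shiftₛ a ^ j) n ⟨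
    ((tₛ ^ j) *ₛ (shiftₛ a ^ j)) (n Nat.+ j)  ≈⟨ ^-distrib-* tₛ (shiftₛ a) j (n Nat.+ j) ⟨
    ((tₛ *ₛ shiftₛ a) ^ j) (n Nat.+ j)        ≈⟨ ^-congˡ j (≈tₛ*ₛshiftₛ {a} a₀≈0) (n Nat.+ j) ⟨
    (a ^ j) (n Nat.+ j)                       ∎

  *ₛ≈tₛ⇒*ₛshiftₛ≈oneₛ : ∀ {a b} → a 0 ≈ 0# → (b *ₛ a) ≈ₛ tₛ → (b *ₛ shiftₛ a) ≈ₛ oneₛ
  *ₛ≈tₛ⇒*ₛshiftₛ≈oneₛ {a} {b} a₀≈0 b*a≈t n = begin
    (b *ₛ shiftₛ a) n                   ≈⟨ coeff-tₛ-*ₛ (b *ₛ shiftₛ a) n ⟨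
    (tₛ *ₛ (b *ₛ shiftₛ a)) (suc n)      ≈⟨ 𝕊ᶜ.x∙yz≈y∙xz tₛ b (shiftₛ a) (suc n) ⟩
    (b *ₛ (tₛ *ₛ shiftₛ a)) (suc n)      ≈⟨ *ₛ-cong (≈ₛ-refl {b}) (≈tₛ*ₛshiftₛ {a} a₀≈0) (suc n) ⟨
    (b *ₛ a) (suc n)                    ≈⟨ b*a≈t (suc n) ⟩
    tₛ (suc n)                          ≈⟨ shiftₛ-tₛ n ⟩
    oneₛ n                              ∎

  coeff-^-below : ∀ {u} → u 0 ≈ 0# → ∀ k i → i < k → (u ^ k) i ≈ 0#
  coeff-^-below u₀≈0 (suc k) zero    _ = trans (*-congʳ u₀≈0) (zeroˡ _)
  coeff-^-below {u} u₀≈0 (suc k) (suc i) (s≤s i<k) = begin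
    (u *ₛ (u ^ k)) (suc i)                           ≈⟨ *ₛ-unfold u (u ^ k) i ⟩
    u 0 * (u ^ k) (suc i) + (shiftₛ u *ₛ (u ^ k)) i  ≈⟨ +-cong (trans (*-congʳ u₀≈0) (zeroˡ _)) (sumTo-zero i below) ⟩
    0# + 0#                                          ≈⟨ +-identityˡ 0# ⟩
    0#                                               ∎
    where
    below : ∀ j → j ≤ i → u (suc j) * (u ^ k) (i ∸ j) ≈ 0#
    below j _ = trans (*-congˡ (coeff-^-below u₀≈0 k (i ∸ j) (ℕₚ.≤-<-trans (ℕₚ.m∸n≤m i j) i<k))) (zeroʳ _)

module BernoulliStirling {c ℓ} (F : CharZeroField c ℓ) where
  open CharZeroField F hiding (zero)
  open Series F
  open PowerSeriesRing F
  open import Algebra.Properties.Ring (CommutativeRing.ring commRing) using (-‿distribˡ-*; -1*x≈-x)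
  open import Algebra.Properties.Group +-group using (x∙y⁻¹≈ε⇒x≈y)
  open import Algebra.Properties.CommutativeSemigroup *-commutativeSemigroup using () renaming (interchange to *-interchange)
  open import Algebra.Solver.Ring.NaturalCoefficients.Default commutativeSemiring using (solve; _:*_; _:=_)
  open import Relation.Binary.Reasoning.Setoid setoid

  1#≉0# : ¬ 1# ≈ 0#
  1#≉0# 1≈0 = charZero 0 (trans (+-identityʳ 1#) 1≈0)

  fromℕ≢0⇒≉0 : ∀ {m} → m ≢ 0 → ¬ fromℕᶠ m ≈ 0#
  fromℕ≢0⇒≉0 {zero}  m≢0 = contradiction ≡.refl m≢0
  fromℕ≢0⇒≉0 {suc m} _   = charZero m

  ⁻¹-inverseˡ : ∀ x → ¬ x ≈ 0# → x ⁻¹ * x ≈ 1#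
  ⁻¹-inverseˡ x x≉0 = trans (*-comm _ _) (inverseʳ x x≉0)

  ≈1#⇒⁻¹≈1# : ∀ {x} → x ≈ 1# → x ⁻¹ ≈ 1#
  ≈1#⇒⁻¹≈1# {x} x≈1 = begin
    x ⁻¹        ≈⟨ *-identityˡ _ ⟨
    1# * x ⁻¹   ≈⟨ *-congʳ x≈1 ⟨
    x * x ⁻¹    ≈⟨ inverseʳ x (λ x≈0 → 1#≉0# (trans (sym x≈1) x≈0)) ⟩
    1#          ∎

  ^ᶠ-distrib-* : ∀ x y j → (x * y) ^ᶠ j ≈ (x ^ᶠ j) * (y ^ᶠ j)
  ^ᶠ-distrib-* x y zero    = sym (*-identityˡ 1#)
  ^ᶠ-distrib-* x y (suc j) = trans (*-congˡ (^ᶠ-distrib-* x y j)) (*-interchange x y _ _)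

  compInverse⇒coeff₁≉0 : ∀ {f fbar} → IsCompInverse f fbar → ¬ fbar 1 ≈ 0#
  compInverse⇒coeff₁≉0 {f} {fbar} (f∘fbar≈t , _) fbar₁≈0 = 1#≉0# (begin
    1#                                            ≈⟨ f∘fbar≈t 1 ⟨
    f 0 * 0# + f 1 * (fbar 0 * 0# + fbar 1 * 1#)  ≈⟨ +-cong (zeroʳ _) (*-congˡ (+-cong (zeroʳ _) fbar₁*1≈0)) ⟩
    0# + f 1 * (0# + 0#)                          ≈⟨ +-identityˡ _ ⟩
    f 1 * (0# + 0#)                               ≈⟨ *-congˡ (+-identityˡ 0#) ⟩
    f 1 * 0#                                      ≈⟨ zeroʳ _ ⟩
    0#                                            ∎)
    where
    fbar₁*1≈0 : fbar 1 * 1# ≈ 0#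
    fbar₁*1≈0 = trans (*-identityʳ _) fbar₁≈0

  expm1-coeff₁ : ∀ h → expm1 h 1 ≈ h 1
  expm1-coeff₁ h = begin
    0# + (1# + 0#) ⁻¹ * (h 0 * 0# + h 1 * 1#)  ≈⟨ +-identityˡ _ ⟩
    (1# + 0#) ⁻¹ * (h 0 * 0# + h 1 * 1#)       ≈⟨ *-cong (≈1#⇒⁻¹≈1# (+-identityʳ 1#)) (+-cong (zeroʳ _) (*-identityʳ _)) ⟩
    1# * (0# + h 1)                            ≈⟨ *-identityˡ _ ⟩
    0# + h 1                                   ≈⟨ +-identityˡ _ ⟩
    h 1                                        ∎

  -- u = 1 - d D has no constant term, so (G * u^(n+1)) n = 0; expanding u^(n+1) = (x + 1)^(n+1)
  -- with x = -d D binomially and using G x = -d isolates G n.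
  reciprocal-coeff : ∀ {D G d} → (G *ₛ D) ≈ₛ oneₛ → d * D 0 ≈ 1# → ∀ n →
    G n ≈ d * sumTo n (λ j → fromℕᶠ (suc n C suc j) * ((-ₛ (constₛ d *ₛ D)) ^ j) n)
  reciprocal-coeff {D} {G} {d} G*D≈1 dD₀≈1 n = begin
    G n                 ≈⟨ x∙y⁻¹≈ε⇒x≈y _ _ (trans (sym (G*u^[n+1]≈G-dR n)) G*u^[n+1]ₙ≈0) ⟩
    (constₛ d *ₛ R) n    ≈⟨ coeff-constₛ-*ₛ d R n ⟩
    d * R n             ≈⟨ *-congˡ (trans (coeff-∑ n (λ j → (suc n C suc j) × x ^ j) n)
                                          (sumTo-cong n (λ j → coeff-× (suc n C suc j) (x ^ j) n))) ⟩
    d * sumTo n (λ j → fromℕᶠ (suc n C suc j) * (x ^ j) n) ∎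
    where
    x R u : PowerSeries
    x = -ₛ (constₛ d *ₛ D)
    R = binomialQuotient powerSeriesRing x n
    u = x +ₛ oneₛ
    u₀≈0 : u 0 ≈ 0#
    u₀≈0 = trans (+-congʳ (-‿cong dD₀≈1)) (-‿inverseˡ 1#)
    G*x≈-d : (G *ₛ x) ≈ₛ (-ₛ constₛ d)
    G*x≈-d = 𝕊.trans (𝕊.sym (𝕊ᵖ.-‿distribʳ-* G (constₛ d *ₛ D)))
               (𝕊.-‿cong (𝕊.trans (𝕊ᶜ.x∙yz≈y∙xz G (constₛ d) D)
                 (𝕊.trans (𝕊.*-congˡ G*D≈1) (𝕊.*-identityʳ (constₛ d)))))
    G*u^[n+1]≈G-dR : (G *ₛ (u ^ suc n)) ≈ₛ (G +ₛ -ₛ (constₛ d *ₛ R))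
    G*u^[n+1]≈G-dR = *[x+1]^[n+1]≈-*binomialQuotient powerSeriesRing G*x≈-d n
    G*u^[n+1]ₙ≈0 : (G *ₛ (u ^ suc n)) n ≈ 0#
    G*u^[n+1]ₙ≈0 = sumTo-zero n (λ i _ →
      trans (*-congˡ (coeff-^-below u₀≈0 (suc n) (n ∸ i) (s≤s (ℕₚ.m∸n≤m n i)))) (zeroʳ _))

  coeff-[-constₛ*ₛ]^ : ∀ k D j n → ((-ₛ (constₛ k *ₛ D)) ^ j) n ≈ ((- 1#) ^ᶠ j) * ((k ^ᶠ j) * (D ^ j) n)
  coeff-[-constₛ*ₛ]^ k D j n = begin
    ((-ₛ (constₛ k *ₛ D)) ^ j) n              ≈⟨ ^-congˡ j -[k*D]≈[-1*k]*D n ⟩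
    ((constₛ (- 1# * k) *ₛ D) ^ j) n          ≈⟨ ^-distrib-* (constₛ (- 1# * k)) D j n ⟩
    ((constₛ (- 1# * k) ^ j) *ₛ (D ^ j)) n    ≈⟨ *ₛ-cong (constₛ-^ (- 1# * k) j) (≈ₛ-refl {D ^ j}) n ⟩
    (constₛ ((- 1# * k) ^ᶠ j) *ₛ (D ^ j)) n   ≈⟨ coeff-constₛ-*ₛ _ (D ^ j) n ⟩
    ((- 1# * k) ^ᶠ j) * (D ^ j) n            ≈⟨ *-congʳ (^ᶠ-distrib-* (- 1#) k j) ⟩
    ((- 1#) ^ᶠ j * k ^ᶠ j) * (D ^ j) n       ≈⟨ *-assoc _ _ _ ⟩
    (- 1#) ^ᶠ j * (k ^ᶠ j * (D ^ j) n)       ∎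
    where
    -[k*D]≈[-1*k]*D : (-ₛ (constₛ k *ₛ D)) ≈ₛ (constₛ (- 1# * k) *ₛ D)
    -[k*D]≈[-1*k]*D m = begin
      - (constₛ k *ₛ D) m          ≈⟨ -‿cong (coeff-constₛ-*ₛ k D m) ⟩
      - (k * D m)                 ≈⟨ -1*x≈-x (k * D m) ⟨
      - 1# * (k * D m)            ≈⟨ *-assoc _ _ _ ⟨
      (- 1# * k) * D m            ≈⟨ coeff-constₛ-*ₛ (- 1# * k) D m ⟨
      (constₛ (- 1# * k) *ₛ D) m   ∎

  -- (n + j)! = C(n + j, j) j! n! cancels the normalisations of S₂ and of the binomial.
  rhs-term≈ : ∀ n j (b s k p e : Carrier) →
    b * (fromℕᶠ ((n Nat.+ j) C j) ⁻¹ * (s * ((k * p) * (fromℕᶠ ((n Nat.+ j) !) * (fromℕᶠ (j !) ⁻¹ * e)))))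
      ≈ fromℕᶠ (n !) * (k * (b * (s * (p * e))))
  rhs-term≈ n j b s k p e = begin
    b * (K ⁻¹ * (s * ((k * p) * (fromℕᶠ ((n Nat.+ j) !) * (J ⁻¹ * e)))))
      ≈⟨ *-congˡ (*-congˡ (*-congˡ (*-congˡ (*-congʳ [n+j]!≈K*J*N)))) ⟩
    b * (K ⁻¹ * (s * ((k * p) * ((K * (J * N)) * (J ⁻¹ * e)))))
      ≈⟨ solve 10 (λ b Ki s k p K J N Ji e →
           b :* (Ki :* (s :* ((k :* p) :* ((K :* (J :* N)) :* (Ji :* e))))) :=
           (K :* Ki) :* ((J :* Ji) :* (N :* (k :* (b :* (s :* (p :* e)))))))
         refl b (K ⁻¹) s k p K J N (J ⁻¹) e ⟩
    (K * K ⁻¹) * ((J * J ⁻¹) * (N * (k * (b * (s * (p * e))))))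
      ≈⟨ *-cong (inverseʳ K K≉0) (*-congʳ (inverseʳ J J≉0)) ⟩
    1# * (1# * (N * (k * (b * (s * (p * e))))))
      ≈⟨ trans (*-identityˡ _) (*-identityˡ _) ⟩
    N * (k * (b * (s * (p * e))))
      ∎
    where
    K J N : Carrier
    K = fromℕᶠ ((n Nat.+ j) C j)
    J = fromℕᶠ (j !)
    N = fromℕᶠ (n !)
    [n+j]!≡ : (n Nat.+ j) ! ≡ ((n Nat.+ j) C j) Nat.* (j ! Nat.* n !)
    [n+j]!≡ = [m+n]!≡[m+n]Cn*n!*m! n j
    [n+j]!≈K*J*N : fromℕᶠ ((n Nat.+ j) !) ≈ K * (J * N)
    [n+j]!≈K*J*N = trans (reflexive (≡.cong fromℕᶠ [n+j]!≡))
      (trans (fromℕ-homo-* commRing ((n Nat.+ j) C j) (j ! Nat.* n !)) (*-congˡ (fromℕ-homo-* commRing (j !) (n !))))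
    J≉0 : ¬ J ≈ 0#
    J≉0 = fromℕ≢0⇒≉0 (Nat.≢-nonZero⁻¹ (j !) {{j ℕₚ.!≢0}})
    K≉0 : ¬ K ≈ 0#
    K≉0 = fromℕ≢0⇒≉0 {(n Nat.+ j) C j} λ C≡0 → Nat.≢-nonZero⁻¹ ((n Nat.+ j) !) {{(n Nat.+ j) ℕₚ.!≢0}}
      (≡.trans [n+j]!≡ (≡.cong (Nat._* (j ! Nat.* n !)) C≡0))

  bernoulli≈rhs : ∀ {f fbar G} → IsCompInverse f fbar → IsBernoulliGF fbar G → ∀ n →
    Bernoulli G n ≈ rhs fbar n
  bernoulli≈rhs {f} {fbar} {G} f∘fbar≈t G*E≈t n = begin
    N * G n                                         ≈⟨ *-congˡ (reciprocal-coeff {D} {G} {k} G*D≈1 kD₀≈1 n) ⟩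
    N * (k * sumTo n (λ j → B j * (x ^ j) n))        ≈⟨ *-congˡ (*-congˡ (sumTo-cong n λ j → *-congˡ (coeff-x^ j))) ⟩
    N * (k * sumTo n T)                             ≈⟨ *-congˡ (*-distribˡ-sumTo n k T) ⟩
    N * sumTo n (λ j → k * T j)                     ≈⟨ *-distribˡ-sumTo n N _ ⟩
    sumTo n (λ j → N * (k * T j))                   ≈⟨ sumTo-cong n (λ j → rhs-term≈ n j (B j) _ k _ _) ⟨
    rhs fbar n                                      ∎
    where
    k N : Carrier
    k = fbar 1 ⁻¹
    N = fromℕᶠ (n !)
    E D x : PowerSeries
    E = expm1 fbar
    D = shiftₛ E
    x = -ₛ (constₛ k *ₛ D)
    B : ℕ → Carrier
    B j = fromℕᶠ (suc n C suc j)
    T : ℕ → Carrier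
    T j = B j * ((- 1#) ^ᶠ j * (k ^ᶠ j * (E ^ₛ j) (n Nat.+ j)))
    G*D≈1 : (G *ₛ D) ≈ₛ oneₛ
    G*D≈1 = *ₛ≈tₛ⇒*ₛshiftₛ≈oneₛ {E} refl G*E≈t
    kD₀≈1 : k * D 0 ≈ 1#
    kD₀≈1 = trans (*-congˡ (expm1-coeff₁ fbar)) (⁻¹-inverseˡ (fbar 1) (compInverse⇒coeff₁≉0 f∘fbar≈t))
    coeff-x^ : ∀ j → (x ^ j) n ≈ (- 1#) ^ᶠ j * (k ^ᶠ j * (E ^ₛ j) (n Nat.+ j))
    coeff-x^ j = trans (coeff-[-constₛ*ₛ]^ k D j n) (*-congˡ (*-congˡ
      (trans (coeff-shiftₛ^ {E} refl j n) (reflexive (≡.cong (λ X → X (n Nat.+ j)) (≡.sym (^ₛ≡^ E j)))))))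

corollary2p6 : ∀ {c ℓ} (F : CharZeroField c ℓ) (f fbar G : Series.PowerSeries F) →
    Series.IsDelta F f → Series.IsCompInverse F f fbar → Series.IsBernoulliGF F fbar G →
    (n : ℕ) → CharZeroField._≈_ F (Series.Bernoulli F G n) (Series.rhs F fbar n)
corollary2p6 F _ _ _ _ = BernoulliStirling.bernoulli≈rhs F
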